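{- Let $t \ge 2$ and $m \ge 2t$ be integers, and let $x$ be an integer with $F_{m-2t+1} \le x < F_{m-2t+3}$. Then \[ A(F_m + x) = t A(x) - A(x - F_{m-2t+2}) + f(t)\, 2^{m-2t}. \]
   Context: The Fibonacci numbers are $F_1 = F_2 = 1$, $F_{m+1} = F_m + F_{m-1}$. For $n \in \mathbb{Z}_{\ge 0}$, $R(n)$ is the number of solutions to $x_1 + \cdots + x_s = n$ with $s \in \mathbb{Z}_{\ge 0}$ and $x_1 < \cdots < x_s$ Fibonacci numbers (partitions of $n$ into distinct Fibonacci numbers; $R(0)=1$). For $H \in \mathbb{Z}$, $A(H) = \sum_{n=0}^{H} R(n)$ (so $A(H)=0$ for $H<0$). For $t \in \mathbb{N}$, $f(t) = 1 + \frac{2(4^{t-1} - 1)}{3}$. -}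

module Defs where

open import Data.Nat using (ℕ; zero; suc; _+_; _*_; _∸_; _^_; _≤_; _<_; _≟_)
open import Data.Nat.DivMod using (_/_)
open import Data.Nat.ListAction using (sum)
open import Data.List using (List; []; _∷_; length; filter; upTo; map; reverse)
open import Data.Integer as ℤ using (ℤ; +_)
open import Relation.Nullary using (Dec; yes; no)

F : ℕ → ℕ
F zero = 0
F (suc zero) = 1
F (suc (suc n)) = F (suc n) + F n

subsets : List ℕ → List (List ℕ)
subsets [] = [] ∷ []
subsets (x ∷ xs) = let ss = subsets xs in Data.List._++_ ss (map (x ∷_) ss)

-- the distinct Fibonacci numbers F 2 < F 3 < ... < F (n+2); these include
-- every Fibonacci number ≤ n (since F (n+2) > n)
fibsUpTo : ℕ → List ℕ
fibsUpTo n = map (λ i → F (suc (suc i))) (upTo (suc n))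

R : ℕ → ℕ
R n = length (filter (λ s → sum s ≟ n) (subsets (fibsUpTo n)))

Aℕ : ℕ → ℕ
Aℕ zero = R 0
Aℕ (suc h) = Aℕ h + R (suc h)

A : ℤ → ℤ
A (+ n) = + Aℕ n
A ℤ.-[1+ n ] = + 0

-- f t = 1 + 2(4^(t-1) - 1)/3  (the division is exact)
f : ℕ → ℕ
f t = 1 + (2 * (4 ^ (t ∸ 1) ∸ 1)) / 3

-- For a weight b : ℤ → ℤ put subsetSum b xs h = Σ_{s ⊆ xs} b (h − Σ s).  With fibs k = [F (k+1), …, F 2]
-- and h < F (k+2), every Fibonacci number ≤ h lies in fibs k, so R h = subsetSum δ (fibs k) h and
-- A h = subsetSum θ (fibs k) h for the indicators δ of {0} and θ of ℤ≥0.
-- Splitting off the two largest parts F (n+3), F (n+2) of fibs (n+2) in A (F (n+3) + x), x < F (n+2):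
-- the sets using neither have sum ≤ F (n+3) − 2 and all count (2^n), those using F (n+3) give A x,
-- and those using only F (n+2) give subsetSum θ (fibs n) (F (n+1) + x), which equals A (F (n+1) + x)
-- once x < F n.  So each step t ↦ t + 1 adds A x + 2^(k+2t−1), and these powers sum to f t · 2^k;
-- for t = 2 the last term is evaluated directly as 2^k + A x − A (x − F (k+2)).
module Submission where

open import Defs
open import Data.Bool using (true; false)
open import Data.List using (List; []; _∷_; [_]; _++_; _∷ʳ_; map; length; filter; upTo)
import Data.List.Properties as List
open import Data.List.Relation.Unary.All using (universal)
open import Data.Nat as ℕ using (ℕ; zero; suc; _≤_; _<_; _∸_; _*_; _^_; _≟_; _≤′_; ≤′-refl; ≤′-step; z≤n; s≤s)
import Data.Nat.Properties as ℕ
open import Data.Nat.DivMod using (_/_; /-congˡ; +-distrib-/-∣ʳ; m*n/n≡m)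
open import Data.Nat.Divisibility using (n∣m*n)
open import Data.Nat.ListAction using (sum)
import Data.Nat.Tactic.RingSolver as ℕ-Solver
open import Data.Integer as ℤ using (ℤ; +_; -[1+_]; 0ℤ; 1ℤ; _+_; _-_; -_)
import Data.Integer.Properties as ℤ
open import Algebra.Properties.CommutativeSemigroup ℤ.+-commutativeSemigroup using () renaming (interchange to +-interchange)
open import Data.Integer.Tactic.RingSolver using (solve-∀)
open import Data.Product using (_,_)
open import Data.Sum using (inj₁; inj₂)
open import Function using (_∘_)
open import Relation.Binary.PropositionalEquality hiding ([_])
open import Relation.Nullary using (Dec; does; ¬_)
open import Relation.Unary using (Decidable; _≐_)

F-≤-suc : ∀ n → F n ≤ F (suc n)
F-≤-suc zero = z≤n
F-≤-suc (suc n) = ℕ.m≤m+n (F (suc n)) (F n)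

F-mono-≤ : ∀ {m n} → m ≤ n → F m ≤ F n
F-mono-≤ = go ∘ ℕ.≤⇒≤′
  where
  go : ∀ {m n} → m ≤′ n → F m ≤ F n
  go ≤′-refl = ℕ.≤-refl
  go (≤′-step {n} m≤′n) = ℕ.≤-trans (go m≤′n) (F-≤-suc n)

n<F[2+n] : ∀ n → n < F (2 ℕ.+ n)
n<F[2+n] zero = s≤s z≤n
n<F[2+n] (suc n) = subst (suc (suc n) ≤_) (ℕ.+-comm (F (suc n)) (F (2 ℕ.+ n)))
  (ℕ.+-mono-≤ (F-mono-≤ {1} {suc n} (s≤s z≤n)) (n<F[2+n] n))

subsetSum : (ℤ → ℤ) → List ℕ → ℤ → ℤ
subsetSum b [] h = b h
subsetSum b (x ∷ xs) h = subsetSum b xs h + subsetSum b xs (h - + x)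

δ : ℤ → ℤ
δ (+ zero) = 1ℤ
δ (+ suc _) = 0ℤ
δ -[1+ _ ] = 0ℤ

θ : ℤ → ℤ
θ (+ _) = 1ℤ
θ -[1+ _ ] = 0ℤ

VanishesOnNegatives : (ℤ → ℤ) → Set
VanishesOnNegatives b = ∀ {h} → h ℤ.< 0ℤ → b h ≡ 0ℤ

δ-vanishesOnNegatives : VanishesOnNegatives δ
δ-vanishesOnNegatives { -[1+ _ ]} _ = refl
δ-vanishesOnNegatives {+ _} (ℤ.+<+ ())

θ-vanishesOnNegatives : VanishesOnNegatives θ
θ-vanishesOnNegatives { -[1+ _ ]} _ = refl
θ-vanishesOnNegatives {+ _} (ℤ.+<+ ())

[i+j]-i≡j : ∀ i j → i + j - i ≡ j
[i+j]-i≡j = solve-∀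

[i+j]-j≡i : ∀ i j → i + j - j ≡ i
[i+j]-j≡i = solve-∀

i-j-k≡i-k-j : ∀ i j k → i - j - k ≡ i - k - j
i-j-k≡i-k-j = solve-∀

i<j⇒i-j<0 : ∀ {i j} → i ℤ.< j → i - j ℤ.< 0ℤ
i<j⇒i-j<0 {i} {j} i<j = subst (i - j ℤ.<_) (ℤ.+-inverseʳ j) (ℤ.+-monoˡ-< (- j) i<j)

i<j+k⇒i-j<k : ∀ {i} j {k} → i ℤ.< j + k → i - j ℤ.< k
i<j+k⇒i-j<k {i} j {k} i<j+k = subst (i - j ℤ.<_) ([i+j]-i≡j j k) (ℤ.+-monoˡ-< (- j) i<j+k)

i+j≤k⇒j≤k-i : ∀ i {j k} → i + j ℤ.≤ k → j ℤ.≤ k - i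
i+j≤k⇒j≤k-i i {j} {k} i+j≤k = subst (ℤ._≤ k - i) ([i+j]-i≡j i j) (ℤ.+-monoˡ-≤ (- i) i+j≤k)

0≤j⇒i≤i+j : ∀ i {j} → 0ℤ ℤ.≤ j → i ℤ.≤ i + j
0≤j⇒i≤i+j i {j} 0≤j = subst (ℤ._≤ i + j) (ℤ.+-identityʳ i) (ℤ.+-monoʳ-≤ i 0≤j)

subsetSum-vanishesOnNegatives : ∀ {b} → VanishesOnNegatives b → ∀ xs → VanishesOnNegatives (subsetSum b xs)
subsetSum-vanishesOnNegatives b-neg [] = b-neg
subsetSum-vanishesOnNegatives b-neg (x ∷ xs) {h} h<0 =
  cong₂ _+_ (subsetSum-vanishesOnNegatives b-neg xs h<0)
            (subsetSum-vanishesOnNegatives b-neg xs (ℤ.≤-<-trans (ℤ.i-j≤i h (+ x)) h<0))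

subsetSum-∷-large : ∀ {b} → VanishesOnNegatives b → ∀ {y} xs {h} → h ℤ.< + y →
                subsetSum b (y ∷ xs) h ≡ subsetSum b xs h
subsetSum-∷-large {b} b-neg {y} xs {h} h<y = begin
  subsetSum b xs h + subsetSum b xs (h - + y)
    ≡⟨ cong (λ z → subsetSum b xs h + z) (subsetSum-vanishesOnNegatives b-neg xs (i<j⇒i-j<0 h<y)) ⟩
  subsetSum b xs h + 0ℤ
    ≡⟨ ℤ.+-identityʳ _ ⟩
  subsetSum b xs h ∎
  where open ≡-Reasoning

subsetSum-∷ʳ : ∀ b xs y h → subsetSum b (xs ∷ʳ y) h ≡ subsetSum b (y ∷ xs) h
subsetSum-∷ʳ b [] y h = refl
subsetSum-∷ʳ b (x ∷ xs) y h = begin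
  subsetSum b (xs ∷ʳ y) h + subsetSum b (xs ∷ʳ y) (h - + x)
    ≡⟨ cong₂ _+_ (subsetSum-∷ʳ b xs y h) (subsetSum-∷ʳ b xs y (h - + x)) ⟩
  (s h + s (h - + y)) + (s (h - + x) + s (h - + x - + y))
    ≡⟨ cong (λ z → (s h + s (h - + y)) + (s (h - + x) + s z)) (i-j-k≡i-k-j h (+ x) (+ y)) ⟩
  (s h + s (h - + y)) + (s (h - + x) + s (h - + y - + x))
    ≡⟨ +-interchange (s h) (s (h - + y)) (s (h - + x)) (s (h - + y - + x)) ⟩
  (s h + s (h - + x)) + (s (h - + y) + s (h - + y - + x)) ∎
  where
  open ≡-Reasoning
  s = subsetSum b xs

subsetSum-θ≡θ-pred+δ : ∀ xs h → subsetSum θ xs h ≡ subsetSum θ xs (h - 1ℤ) + subsetSum δ xs h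
subsetSum-θ≡θ-pred+δ [] (+ zero) = refl
subsetSum-θ≡θ-pred+δ [] (+ suc _) = refl
subsetSum-θ≡θ-pred+δ [] -[1+ _ ] = refl
subsetSum-θ≡θ-pred+δ (x ∷ xs) h = begin
  Θ h + Θ (h - + x)
    ≡⟨ cong₂ _+_ (subsetSum-θ≡θ-pred+δ xs h) (subsetSum-θ≡θ-pred+δ xs (h - + x)) ⟩
  (Θ (h - 1ℤ) + Δ h) + (Θ (h - + x - 1ℤ) + Δ (h - + x))
    ≡⟨ cong (λ z → (Θ (h - 1ℤ) + Δ h) + (Θ z + Δ (h - + x))) (i-j-k≡i-k-j h (+ x) 1ℤ) ⟩
  (Θ (h - 1ℤ) + Δ h) + (Θ (h - 1ℤ - + x) + Δ (h - + x))
    ≡⟨ +-interchange (Θ (h - 1ℤ)) (Δ h) (Θ (h - 1ℤ - + x)) (Δ (h - + x)) ⟩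
  (Θ (h - 1ℤ) + Θ (h - 1ℤ - + x)) + (Δ h + Δ (h - + x)) ∎
  where
  open ≡-Reasoning
  Θ = subsetSum θ xs
  Δ = subsetSum δ xs

subsetSum-θ-≥sum : ∀ xs {h} → + sum xs ℤ.≤ h → subsetSum θ xs h ≡ + (2 ^ length xs)
subsetSum-θ-≥sum [] {+ _} _ = refl
subsetSum-θ-≥sum (x ∷ xs) {h} x+Σ≤h = begin
  subsetSum θ xs h + subsetSum θ xs (h - + x)
    ≡⟨ cong₂ _+_ (subsetSum-θ-≥sum xs Σ≤h) (subsetSum-θ-≥sum xs Σ≤h-x) ⟩
  + (2 ^ length xs) + + (2 ^ length xs)
    ≡⟨ sym (ℤ.pos-+ (2 ^ length xs) (2 ^ length xs)) ⟩
  + (2 ^ length xs ℕ.+ 2 ^ length xs)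
    ≡⟨ cong (λ n → + (2 ^ length xs ℕ.+ n)) (sym (ℕ.+-identityʳ (2 ^ length xs))) ⟩
  + (2 ^ suc (length xs)) ∎
  where
  open ≡-Reasoning
  Σ≤h : + sum xs ℤ.≤ h
  Σ≤h = ℤ.≤-trans (ℤ.+≤+ (ℕ.m≤n+m (sum xs) x)) x+Σ≤h
  Σ≤h-x : + sum xs ℤ.≤ h - + x
  Σ≤h-x = i+j≤k⇒j≤k-i (+ x) (subst (ℤ._≤ h) (ℤ.pos-+ x (sum xs)) x+Σ≤h)

filter-map : ∀ {A B : Set} {P : B → Set} (P? : Decidable P) (f : A → B) xs →
             filter P? (map f xs) ≡ map f (filter (P? ∘ f) xs)
filter-map P? f [] = refl
filter-map P? f (x ∷ xs) with does (P? (f x))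
... | true = cong (f x ∷_) (filter-map P? f xs)
... | false = filter-map P? f xs

+length-filter-sum≡-subsets : ∀ xs n → + length (filter (λ s → sum s ≟ n) (subsets xs)) ≡ subsetSum δ xs (+ n)
+length-filter-sum≡-subsets [] zero = refl
+length-filter-sum≡-subsets [] (suc n) = refl
+length-filter-sum≡-subsets (x ∷ xs) n = begin
  + length (filter (sum≟ n) (ss ++ map (x ∷_) ss))
    ≡⟨ cong (+_ ∘ length) (List.filter-++ (sum≟ n) ss (map (x ∷_) ss)) ⟩
  + length (filter (sum≟ n) ss ++ filter (sum≟ n) (map (x ∷_) ss))
    ≡⟨ cong +_ (List.length-++ (filter (sum≟ n) ss)) ⟩
  + (length (filter (sum≟ n) ss) ℕ.+ length (filter (sum≟ n) (map (x ∷_) ss)))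
    ≡⟨ ℤ.pos-+ (length (filter (sum≟ n) ss)) _ ⟩
  + length (filter (sum≟ n) ss) + + length (filter (sum≟ n) (map (x ∷_) ss))
    ≡⟨ cong₂ _+_ (+length-filter-sum≡-subsets xs n) sums-with-x ⟩
  subsetSum δ xs (+ n) + subsetSum δ xs (+ n - + x) ∎
  where
  open ≡-Reasoning
  ss = subsets xs
  sum≟ : ∀ n s → Dec (sum s ≡ n)
  sum≟ n s = sum s ≟ n
  x+sum≟ : ∀ s → Dec (x ℕ.+ sum s ≡ n)
  x+sum≟ s = x ℕ.+ sum s ≟ n
  sums-with-x : + length (filter (sum≟ n) (map (x ∷_) ss)) ≡ subsetSum δ xs (+ n - + x)
  sums-with-x rewrite filter-map (sum≟ n) (x ∷_) ss | List.length-map (x ∷_) (filter x+sum≟ ss)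
    with ℕ.≤-<-connex x n
  ... | inj₁ x≤n = begin
    + length (filter x+sum≟ ss)     ≡⟨ cong (+_ ∘ length) (List.filter-≐ x+sum≟ (sum≟ (n ∸ x)) x+s≐s ss) ⟩
    + length (filter (sum≟ (n ∸ x)) ss) ≡⟨ +length-filter-sum≡-subsets xs (n ∸ x) ⟩
    subsetSum δ xs (+ (n ∸ x))      ≡⟨ cong (subsetSum δ xs) (sym (trans (ℤ.m-n≡m⊖n n x) (ℤ.⊖-≥ x≤n))) ⟩
    subsetSum δ xs (+ n - + x)      ∎
    where
    x+s≐s : (λ s → x ℕ.+ sum s ≡ n) ≐ (λ s → sum s ≡ n ∸ x)
    x+s≐s = (λ {s} eq → trans (sym (ℕ.m+n∸m≡n x (sum s))) (cong (_∸ x) eq))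
          , (λ eq → trans (cong (x ℕ.+_) eq) (ℕ.m+[n∸m]≡n x≤n))
  ... | inj₂ n<x = begin
    + length (filter x+sum≟ ss) ≡⟨ cong (+_ ∘ length) (List.filter-none x+sum≟ (universal x+s≢n ss)) ⟩
    0ℤ                          ≡⟨ sym (subsetSum-vanishesOnNegatives δ-vanishesOnNegatives xs n-x<0) ⟩
    subsetSum δ xs (+ n - + x)  ∎
    where
    x+s≢n : ∀ s → ¬ (x ℕ.+ sum s ≡ n)
    x+s≢n s eq = ℕ.<⇒≱ n<x (subst (x ≤_) eq (ℕ.m≤m+n x (sum s)))
    n-x<0 : + n - + x ℤ.< 0ℤ
    n-x<0 = i<j⇒i-j<0 (ℤ.+<+ n<x)

fibs : ℕ → List ℕ
fibs zero = []
fibs (suc k) = F (2 ℕ.+ k) ∷ fibs k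

length-fibs : ∀ k → length (fibs k) ≡ k
length-fibs zero = refl
length-fibs (suc k) = cong suc (length-fibs k)

sum-fibs≤F : ∀ k → sum (fibs k) ≤ F (3 ℕ.+ k)
sum-fibs≤F zero = z≤n
sum-fibs≤F (suc k) = subst (F (2 ℕ.+ k) ℕ.+ sum (fibs k) ≤_) (ℕ.+-comm (F (2 ℕ.+ k)) (F (3 ℕ.+ k)))
                           (ℕ.+-monoʳ-≤ (F (2 ℕ.+ k)) (sum-fibs≤F k))

subsetSum-fibsUpTo : ∀ b k h → subsetSum b (map (λ i → F (2 ℕ.+ i)) (upTo k)) h ≡ subsetSum b (fibs k) h
subsetSum-fibsUpTo b zero h = refl
subsetSum-fibsUpTo b (suc k) h = begin
  subsetSum b (map g (upTo (suc k))) h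
    ≡⟨ cong (λ is → subsetSum b (map g is) h) (sym (List.upTo-∷ʳ k)) ⟩
  subsetSum b (map g (upTo k ∷ʳ k)) h
    ≡⟨ cong (λ is → subsetSum b is h) (List.map-++ g (upTo k) [ k ]) ⟩
  subsetSum b (map g (upTo k) ∷ʳ g k) h
    ≡⟨ subsetSum-∷ʳ b (map g (upTo k)) (g k) h ⟩
  subsetSum b (map g (upTo k)) h + subsetSum b (map g (upTo k)) (h - + g k)
    ≡⟨ cong₂ _+_ (subsetSum-fibsUpTo b k h) (subsetSum-fibsUpTo b k (h - + g k)) ⟩
  subsetSum b (fibs (suc k)) h ∎
  where
  open ≡-Reasoning
  g : ℕ → ℕ
  g i = F (2 ℕ.+ i)

subsetSum-fibs-+ : ∀ {b} → VanishesOnNegatives b → ∀ j k {h} → h ℤ.< + F (2 ℕ.+ k) →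
                   subsetSum b (fibs (j ℕ.+ k)) h ≡ subsetSum b (fibs k) h
subsetSum-fibs-+ b-neg zero k h<F = refl
subsetSum-fibs-+ b-neg (suc j) k h<F =
  trans (subsetSum-∷-large b-neg (fibs (j ℕ.+ k))
          (ℤ.<-≤-trans h<F (ℤ.+≤+ (F-mono-≤ (s≤s (s≤s (ℕ.m≤n+m k j)))))))
        (subsetSum-fibs-+ b-neg j k h<F)

subsetSum-fibs-stable : ∀ {b} → VanishesOnNegatives b → ∀ {k l h} →
                        h ℤ.< + F (2 ℕ.+ k) → h ℤ.< + F (2 ℕ.+ l) →
                        subsetSum b (fibs k) h ≡ subsetSum b (fibs l) h
subsetSum-fibs-stable b-neg {k} {l} h<Fk h<Fl with ℕ.≤-total k l
... | inj₁ k≤l = sym (subst (λ i → subsetSum _ (fibs i) _ ≡ _) (ℕ.m∸n+n≡m k≤l)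
                            (subsetSum-fibs-+ b-neg (l ∸ k) k h<Fk))
... | inj₂ l≤k = subst (λ i → subsetSum _ (fibs i) _ ≡ _) (ℕ.m∸n+n≡m l≤k)
                       (subsetSum-fibs-+ b-neg (k ∸ l) l h<Fl)

R≡subsetSum-δ-fibs : ∀ k {n} → n < F (2 ℕ.+ k) → + R n ≡ subsetSum δ (fibs k) (+ n)
R≡subsetSum-δ-fibs k {n} n<F = begin
  + R n
    ≡⟨ +length-filter-sum≡-subsets (fibsUpTo n) n ⟩
  subsetSum δ (fibsUpTo n) (+ n)
    ≡⟨ subsetSum-fibsUpTo δ (suc n) (+ n) ⟩
  subsetSum δ (fibs (suc n)) (+ n)
    ≡⟨ subsetSum-fibs-stable δ-vanishesOnNegatives {suc n} {k} (ℤ.+<+ n<F[3+n]) (ℤ.+<+ n<F) ⟩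
  subsetSum δ (fibs k) (+ n) ∎
  where
  open ≡-Reasoning
  n<F[3+n] : n < F (3 ℕ.+ n)
  n<F[3+n] = ℕ.<-≤-trans (n<F[2+n] n) (F-≤-suc (2 ℕ.+ n))

A≡subsetSum-θ-fibs : ∀ k {h} → h ℤ.< + F (2 ℕ.+ k) → A h ≡ subsetSum θ (fibs k) h
A≡subsetSum-θ-fibs k { -[1+ n ]} _ =
  sym (subsetSum-vanishesOnNegatives θ-vanishesOnNegatives (fibs k) ℤ.-<+)
A≡subsetSum-θ-fibs k {+ n} (ℤ.+<+ n<F) = Aℕ≡ n n<F
  where
  Θ Δ : ℤ → ℤ
  Θ = subsetSum θ (fibs k)
  Δ = subsetSum δ (fibs k)
  Aℕ≡ : ∀ n → n < F (2 ℕ.+ k) → + Aℕ n ≡ Θ (+ n)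
  Aℕ≡ zero 0<F = begin
    + R 0             ≡⟨ R≡subsetSum-δ-fibs k 0<F ⟩
    Δ 0ℤ              ≡⟨ sym (ℤ.+-identityˡ (Δ 0ℤ)) ⟩
    0ℤ + Δ 0ℤ         ≡⟨ cong (_+ Δ 0ℤ) (sym (subsetSum-vanishesOnNegatives θ-vanishesOnNegatives (fibs k) ℤ.-<+)) ⟩
    Θ (- 1ℤ) + Δ 0ℤ   ≡⟨ sym (subsetSum-θ≡θ-pred+δ (fibs k) 0ℤ) ⟩
    Θ 0ℤ              ∎
    where open ≡-Reasoning
  Aℕ≡ (suc n) 1+n<F = begin
    + (Aℕ n ℕ.+ R (suc n))     ≡⟨ ℤ.pos-+ (Aℕ n) (R (suc n)) ⟩
    + Aℕ n + + R (suc n)       ≡⟨ cong₂ _+_ (Aℕ≡ n (ℕ.<-trans (ℕ.n<1+n n) 1+n<F)) (R≡subsetSum-δ-fibs k 1+n<F) ⟩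
    Θ (+ n) + Δ (+ suc n)      ≡⟨ sym (subsetSum-θ≡θ-pred+δ (fibs k) (+ suc n)) ⟩
    Θ (+ suc n)                ∎
    where open ≡-Reasoning

f-suc : ∀ t → f (2 ℕ.+ t) ≡ f (1 ℕ.+ t) ℕ.+ 2 * 4 ^ t
f-suc t = cong suc (begin
  2 * (4 * 4 ^ t ∸ 1) / 3                   ≡⟨ /-congˡ (regroup (4 ^ t) (ℕ.m^n>0 4 t)) ⟩
  (2 * (4 ^ t ∸ 1) ℕ.+ 2 * 4 ^ t * 3) / 3   ≡⟨ +-distrib-/-∣ʳ (2 * (4 ^ t ∸ 1)) (n∣m*n (2 * 4 ^ t)) ⟩
  2 * (4 ^ t ∸ 1) / 3 ℕ.+ 2 * 4 ^ t * 3 / 3 ≡⟨ cong (2 * (4 ^ t ∸ 1) / 3 ℕ.+_) (m*n/n≡m (2 * 4 ^ t) 3) ⟩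
  2 * (4 ^ t ∸ 1) / 3 ℕ.+ 2 * 4 ^ t         ∎)
  where
  open ≡-Reasoning
  regroup : ∀ n → 0 < n → 2 * (4 * n ∸ 1) ≡ 2 * (n ∸ 1) ℕ.+ 2 * n * 3
  regroup (suc n) _ = regroup-suc n
    where
    regroup-suc : ∀ n → 2 * (n ℕ.+ 3 * suc n) ≡ 2 * n ℕ.+ 2 * suc n * 3
    regroup-suc = ℕ-Solver.solve-∀

f[3+s]*2^k : ∀ s k → f (3 ℕ.+ s) * 2 ^ k ≡ f (2 ℕ.+ s) * 2 ^ k ℕ.+ 2 ^ (1 ℕ.+ 2 * (1 ℕ.+ s) ℕ.+ k)
f[3+s]*2^k s k = begin
  f (3 ℕ.+ s) * 2 ^ k                               ≡⟨ cong (_* 2 ^ k) (f-suc (1 ℕ.+ s)) ⟩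
  (f (2 ℕ.+ s) ℕ.+ 2 * 4 ^ (1 ℕ.+ s)) * 2 ^ k       ≡⟨ ℕ.*-distribʳ-+ (2 ^ k) (f (2 ℕ.+ s)) _ ⟩
  f (2 ℕ.+ s) * 2 ^ k ℕ.+ 2 * 4 ^ (1 ℕ.+ s) * 2 ^ k
    ≡⟨ cong (λ n → f (2 ℕ.+ s) * 2 ^ k ℕ.+ 2 * n * 2 ^ k) (ℕ.^-*-assoc 2 2 (1 ℕ.+ s)) ⟩
  f (2 ℕ.+ s) * 2 ^ k ℕ.+ 2 ^ (1 ℕ.+ 2 * (1 ℕ.+ s)) * 2 ^ k
    ≡⟨ cong (f (2 ℕ.+ s) * 2 ^ k ℕ.+_) (sym (ℕ.^-distribˡ-+-* 2 (1 ℕ.+ 2 * (1 ℕ.+ s)) k)) ⟩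
  f (2 ℕ.+ s) * 2 ^ k ℕ.+ 2 ^ (1 ℕ.+ 2 * (1 ℕ.+ s) ℕ.+ k) ∎
  where open ≡-Reasoning

+F[2+n] : ∀ n → + F (2 ℕ.+ n) ≡ + F (1 ℕ.+ n) + + F n
+F[2+n] n = ℤ.pos-+ (F (1 ℕ.+ n)) (F n)

subsetSum-θ-fibs-≥F : ∀ k {h} → + F (3 ℕ.+ k) ℤ.≤ h → subsetSum θ (fibs k) h ≡ + (2 ^ k)
subsetSum-θ-fibs-≥F k F≤h =
  trans (subsetSum-θ-≥sum (fibs k) (ℤ.≤-trans (ℤ.+≤+ (sum-fibs≤F k)) F≤h))
        (cong (λ n → + (2 ^ n)) (length-fibs k))

A-F[3+n]+ : ∀ n {x} → 0ℤ ℤ.≤ x → x ℤ.< + F (2 ℕ.+ n) →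
            A (+ F (3 ℕ.+ n) + x) ≡ A x + + (2 ^ n) + subsetSum θ (fibs n) (+ F (1 ℕ.+ n) + x)
A-F[3+n]+ n {x} 0≤x x<F = begin
  A h
    ≡⟨ A≡subsetSum-θ-fibs (2 ℕ.+ n) h<F ⟩
  Θ n h + Θ n (h - + F (2 ℕ.+ n)) + Θ (1 ℕ.+ n) (h - + F (3 ℕ.+ n))
    ≡⟨ cong₂ _+_ (cong₂ _+_ (subsetSum-θ-fibs-≥F n F≤h) (cong (Θ n) h-F≡))
                 (cong (Θ (1 ℕ.+ n)) ([i+j]-i≡j (+ F (3 ℕ.+ n)) x)) ⟩
  + (2 ^ n) + Θ n (+ F (1 ℕ.+ n) + x) + Θ (1 ℕ.+ n) x
    ≡⟨ cong (λ z → + (2 ^ n) + Θ n (+ F (1 ℕ.+ n) + x) + z) (sym (A≡subsetSum-θ-fibs (1 ℕ.+ n) x<F′)) ⟩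
  + (2 ^ n) + Θ n (+ F (1 ℕ.+ n) + x) + A x
    ≡⟨ rotate (+ (2 ^ n)) (Θ n (+ F (1 ℕ.+ n) + x)) (A x) ⟩
  A x + + (2 ^ n) + Θ n (+ F (1 ℕ.+ n) + x) ∎
  where
  open ≡-Reasoning
  Θ : ℕ → ℤ → ℤ
  Θ k = subsetSum θ (fibs k)
  h = + F (3 ℕ.+ n) + x
  F≤h : + F (3 ℕ.+ n) ℤ.≤ h
  F≤h = 0≤j⇒i≤i+j (+ F (3 ℕ.+ n)) 0≤x
  h<F : h ℤ.< + F (4 ℕ.+ n)
  h<F = subst (h ℤ.<_) (sym (+F[2+n] (2 ℕ.+ n))) (ℤ.+-monoʳ-< (+ F (3 ℕ.+ n)) x<F)
  x<F′ : x ℤ.< + F (3 ℕ.+ n)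
  x<F′ = ℤ.<-≤-trans x<F (ℤ.+≤+ (F-≤-suc (2 ℕ.+ n)))
  h-F≡ : h - + F (2 ℕ.+ n) ≡ + F (1 ℕ.+ n) + x
  h-F≡ = trans (cong (λ z → z + x - + F (2 ℕ.+ n)) (+F[2+n] (1 ℕ.+ n))) (cancel (+ F (2 ℕ.+ n)) (+ F (1 ℕ.+ n)) x)
    where
    cancel : ∀ a b x → a + b + x - a ≡ b + x
    cancel = solve-∀
  rotate : ∀ a b c → a + b + c ≡ c + a + b
  rotate = solve-∀

subsetSum-θ-fibs[1+k]-F[2+k]+ : ∀ k {x} → + F (1 ℕ.+ k) ℤ.≤ x → x ℤ.< + F (3 ℕ.+ k) →
  subsetSum θ (fibs (1 ℕ.+ k)) (+ F (2 ℕ.+ k) + x) ≡ + (2 ^ k) + (A x - A (x - + F (2 ℕ.+ k)))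
subsetSum-θ-fibs[1+k]-F[2+k]+ k {x} F≤x x<F = begin
  Θ (+ F (2 ℕ.+ k) + x) + Θ (+ F (2 ℕ.+ k) + x - + F (2 ℕ.+ k))
    ≡⟨ cong₂ _+_ (subsetSum-θ-fibs-≥F k F≤h) (cong Θ ([i+j]-i≡j (+ F (2 ℕ.+ k)) x)) ⟩
  + (2 ^ k) + Θ x
    ≡⟨ cong (λ z → + (2 ^ k) + z) Θx≡ ⟩
  + (2 ^ k) + (A x - A (x - + F (2 ℕ.+ k))) ∎
  where
  open ≡-Reasoning
  Θ : ℤ → ℤ
  Θ = subsetSum θ (fibs k)
  F≤h : + F (3 ℕ.+ k) ℤ.≤ + F (2 ℕ.+ k) + x
  F≤h = subst (ℤ._≤ + F (2 ℕ.+ k) + x) (sym (+F[2+n] (1 ℕ.+ k))) (ℤ.+-monoʳ-≤ (+ F (2 ℕ.+ k)) F≤x)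
  x-F<F : x - + F (2 ℕ.+ k) ℤ.< + F (2 ℕ.+ k)
  x-F<F = ℤ.<-≤-trans (i<j+k⇒i-j<k (+ F (2 ℕ.+ k)) (subst (x ℤ.<_) (+F[2+n] (1 ℕ.+ k)) x<F))
                      (ℤ.+≤+ (F-≤-suc (1 ℕ.+ k)))
  Ax≡ : A x ≡ Θ x + A (x - + F (2 ℕ.+ k))
  Ax≡ = trans (A≡subsetSum-θ-fibs (1 ℕ.+ k) x<F)
              (cong (λ z → Θ x + z) (sym (A≡subsetSum-θ-fibs k x-F<F)))
  Θx≡ : Θ x ≡ A x - A (x - + F (2 ℕ.+ k))
  Θx≡ = trans (sym ([i+j]-j≡i (Θ x) (A (x - + F (2 ℕ.+ k))))) (cong (_- A (x - + F (2 ℕ.+ k))) (sym Ax≡))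

A-F[2t+k]+ : ∀ s k {x} → + F (1 ℕ.+ k) ℤ.≤ x → x ℤ.< + F (3 ℕ.+ k) →
  A (+ F (2 * (2 ℕ.+ s) ℕ.+ k) + x) ≡ + (2 ℕ.+ s) ℤ.* A x - A (x - + F (2 ℕ.+ k)) + + (f (2 ℕ.+ s) * 2 ^ k)
A-F[2t+k]+ zero k {x} F≤x x<F = begin
  A (+ F (3 ℕ.+ (1 ℕ.+ k)) + x)
    ≡⟨ A-F[3+n]+ (1 ℕ.+ k) 0≤x (ℤ.<-≤-trans x<F (ℤ.+≤+ ℕ.≤-refl)) ⟩
  A x + + (2 ^ (1 ℕ.+ k)) + subsetSum θ (fibs (1 ℕ.+ k)) (+ F (2 ℕ.+ k) + x)
    ≡⟨ cong₂ (λ a b → A x + a + b) (ℤ.pos-* 2 (2 ^ k)) (subsetSum-θ-fibs[1+k]-F[2+k]+ k F≤x x<F) ⟩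
  A x + + 2 ℤ.* + (2 ^ k) + (+ (2 ^ k) + (A x - Y))
    ≡⟨ collect (A x) Y (+ (2 ^ k)) ⟩
  + 2 ℤ.* A x - Y + + 3 ℤ.* + (2 ^ k)
    ≡⟨ cong (λ z → + 2 ℤ.* A x - Y + z) (sym (ℤ.pos-* 3 (2 ^ k))) ⟩
  + 2 ℤ.* A x - Y + + (f 2 * 2 ^ k) ∎
  where
  open ≡-Reasoning
  Y = A (x - + F (2 ℕ.+ k))
  0≤x : 0ℤ ℤ.≤ x
  0≤x = ℤ.≤-trans (ℤ.+≤+ z≤n) F≤x
  collect : ∀ X Y P → X + + 2 ℤ.* P + (P + (X - Y)) ≡ + 2 ℤ.* X - Y + + 3 ℤ.* P
  collect = solve-∀
A-F[2t+k]+ (suc s) k {x} F≤x x<F = begin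
  A (+ F (2 * (3 ℕ.+ s) ℕ.+ k) + x)
    ≡⟨ cong (λ i → A (+ F i + x)) (index-3+n s k) ⟩
  A (+ F (3 ℕ.+ n) + x)
    ≡⟨ A-F[3+n]+ n 0≤x (ℤ.<-≤-trans x<F (ℤ.+≤+ (F-mono-≤ 3+k≤2+n))) ⟩
  A x + + (2 ^ n) + subsetSum θ (fibs n) (+ F (1 ℕ.+ n) + x)
    ≡⟨ cong (λ z → A x + + (2 ^ n) + z) (sym (A≡subsetSum-θ-fibs n F+x<F)) ⟩
  A x + + (2 ^ n) + A (+ F (1 ℕ.+ n) + x)
    ≡⟨ cong (λ i → A x + + (2 ^ n) + A (+ F i + x)) (index-1+n s k) ⟩
  A x + + (2 ^ n) + A (+ F (2 * (2 ℕ.+ s) ℕ.+ k) + x)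
    ≡⟨ cong (λ z → A x + + (2 ^ n) + z) (A-F[2t+k]+ s k F≤x x<F) ⟩
  A x + + (2 ^ n) + (+ (2 ℕ.+ s) ℤ.* A x - Y + + (f (2 ℕ.+ s) * 2 ^ k))
    ≡⟨ collect (A x) Y (+ (2 ℕ.+ s)) (+ (f (2 ℕ.+ s) * 2 ^ k)) (+ (2 ^ n)) ⟩
  (+ 1 + + (2 ℕ.+ s)) ℤ.* A x - Y + (+ (f (2 ℕ.+ s) * 2 ^ k) + + (2 ^ n))
    ≡⟨ cong₂ (λ a b → a ℤ.* A x - Y + b) (sym (ℤ.pos-+ 1 (2 ℕ.+ s)))
             (trans (sym (ℤ.pos-+ (f (2 ℕ.+ s) * 2 ^ k) (2 ^ n))) (cong +_ (sym (f[3+s]*2^k s k)))) ⟩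
  + (3 ℕ.+ s) ℤ.* A x - Y + + (f (3 ℕ.+ s) * 2 ^ k) ∎
  where
  open ≡-Reasoning
  n = 1 ℕ.+ 2 * (1 ℕ.+ s) ℕ.+ k
  Y = A (x - + F (2 ℕ.+ k))
  0≤x : 0ℤ ℤ.≤ x
  0≤x = ℤ.≤-trans (ℤ.+≤+ z≤n) F≤x
  3+k≤n : 3 ℕ.+ k ≤ n
  3+k≤n = s≤s (ℕ.+-monoˡ-≤ k (ℕ.*-monoʳ-≤ 2 (s≤s z≤n)))
  3+k≤2+n : 3 ℕ.+ k ≤ 2 ℕ.+ n
  3+k≤2+n = ℕ.≤-trans 3+k≤n (ℕ.m≤n+m n 2)
  F+x<F : + F (1 ℕ.+ n) + x ℤ.< + F (2 ℕ.+ n)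
  F+x<F = subst (+ F (1 ℕ.+ n) + x ℤ.<_) (sym (+F[2+n] n))
                (ℤ.+-monoʳ-< (+ F (1 ℕ.+ n)) (ℤ.<-≤-trans x<F (ℤ.+≤+ (F-mono-≤ 3+k≤n))))
  index-3+n : ∀ s k → 2 * (3 ℕ.+ s) ℕ.+ k ≡ 3 ℕ.+ (1 ℕ.+ 2 * (1 ℕ.+ s) ℕ.+ k)
  index-3+n = ℕ-Solver.solve-∀
  index-1+n : ∀ s k → 1 ℕ.+ (1 ℕ.+ 2 * (1 ℕ.+ s) ℕ.+ k) ≡ 2 * (2 ℕ.+ s) ℕ.+ k
  index-1+n = ℕ-Solver.solve-∀
  collect : ∀ X Y T P Q → X + Q + (T ℤ.* X - Y + P) ≡ (+ 1 + T) ℤ.* X - Y + (P + Q)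
  collect = solve-∀

lemma3p2 : (t m : ℕ) (x : ℤ) → 2 ≤ t → 2 * t ≤ m →
    + F (m ∸ 2 * t ℕ.+ 1) ℤ.≤ x → x ℤ.< + F (m ∸ 2 * t ℕ.+ 3) →
    A (+ F m + x) ≡ (+ t ℤ.* A x) - A (x - + F (m ∸ 2 * t ℕ.+ 2)) + + (f t ℕ.* 2 ^ (m ∸ 2 * t))
lemma3p2 t@(suc (suc s)) m x (s≤s (s≤s _)) 2t≤m F≤x x<F =
  subst₂ (λ i j → A (+ F i + x) ≡ + t ℤ.* A x - A (x - + F j) + + (f t * 2 ^ k))
         (ℕ.m+[n∸m]≡n 2t≤m) (ℕ.+-comm 2 k)
         (A-F[2t+k]+ s k (subst (λ i → + F i ℤ.≤ x) (ℕ.+-comm k 1) F≤x)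
                         (subst (λ i → x ℤ.< + F i) (ℕ.+-comm k 3) x<F))
  where
  k = m ∸ 2 * t
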